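{- Let $g \ge 3$ and $n \ge 0$, and let $A$ be an integral domain whose fraction field $F$ has characteristic zero. If $g - 1 \notin A^\times$, then $\zeta_n$ does not restrict to a section of the projection $r : \Lambda^3_{n+1} H_A \to \Lambda^3_n H_A$; that is, $\zeta_n(\Lambda^3_n H_A) \not\subseteq \Lambda^3_{n+1} H_A$.
   Context: $H_A$ is a free $A$-module of rank $2g$ with a unimodular skew form, $H_F = H_A\otimes_A F$, and $\mathrm{GSp}$, Tate twists $(r)$ are as usual ($\mathrm{GSp}$ acting on $A(r)$ by the $r$-th power of the multiplier). $\check\theta \in \Lambda^2 H_A(-1)$ is dual to the form ($\sum a_i\wedge b_i$ for a symplectic basis). $\Lambda^3_0 H_A = (\Lambda^3 H_A)(-1)/(\check\theta \wedge H_A)$; for $u \in \Lambda^3 H_A$ let $\bar u$ be its image in $(\Lambda^3_0 H_A)(1)$. For $n\ge 1$, $\Lambda^3_n H_A = \{(u_1,\dots,u_n) \in (\Lambda^3 H_A)^n : \bar u_1 = \cdots = \bar u_n\}(-1)$, and $\Lambda^3_0 H_A := \Lambda^3_0H_A$; similarly over $F$. The map $r : \Lambda^3_{n+1}H_A \to \Lambda^3_n H_A$ is $(u_0,u_1,\dots,u_n)\mapsto(u_1,\dots,u_n)$ (for $n=0$, the quotient map). Over $F$, the unique $\mathrm{GSp}(H_F)$-equivariant splitting $(\Lambda^3 H_F)(-1) = H_F \oplus \Lambda^3_0 H_F$ gives $\Lambda^3_n H_F \cong \Lambda^3_0 H_F \oplus H_F^n$, whose elements we write $(v; h_1,\dots,h_n)$.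 Then $\zeta_n : \Lambda^3_n H_F \to \Lambda^3_{n+1}H_F$ is $(v; h_1,\dots,h_n) \mapsto (v; 0, h_1,\dots,h_n)$, a section of $r\otimes F$. -}

module Defs where

open import Level using (Level; _⊔_; Lift)
open import Algebra.Bundles using (CommutativeRing)
open import Algebra.Morphism.Structures using (IsRingHomomorphism)
open import Data.Nat.Base as ℕ using (ℕ; zero; suc)
open import Data.Fin.Base using (Fin; zero; suc; splitAt)
open import Data.Fin.Properties using (_≟_)
open import Data.Sum.Base using (_⊎_; inj₁; inj₂)
open import Data.Product.Base using (Σ; ∃; _×_; _,_; proj₁; proj₂)
open import Data.Vec.Functional using (Vector; _∷_)
open import Relation.Nullary using (¬_; does)
open import Data.Bool.Base using (if_then_else_)
open import Function.Definitions using (Injective)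

module _ {c ℓ} (R : CommutativeRing c ℓ) where
  open CommutativeRing R using (Carrier; _≈_; _+_; _*_; 0#; 1#)

  natR : ℕ → Carrier
  natR zero    = 0#
  natR (suc n) = 1# + natR n

  IsUnit : Carrier → Set (c ⊔ ℓ)
  IsUnit x = ∃ λ y → x * y ≈ 1#

  record IsIntegralDomain : Set (c ⊔ ℓ) where
    field
      nontrivial  : ¬ (1# ≈ 0#)
      noZeroDivs  : ∀ x y → x * y ≈ 0# → (x ≈ 0#) ⊎ (y ≈ 0#)

  record IsField : Set (c ⊔ ℓ) where
    field
      nontrivial : ¬ (1# ≈ 0#)
      inverses   : ∀ x → ¬ (x ≈ 0#) → IsUnit x

  CharZero : Set ℓ
  CharZero = ∀ n → ¬ (natR (suc n) ≈ 0#)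

record IsFractionField {c ℓ c' ℓ'} (A : CommutativeRing c ℓ) (F : CommutativeRing c' ℓ')
       (ι : CommutativeRing.Carrier A → CommutativeRing.Carrier F) : Set (c ⊔ ℓ ⊔ c' ⊔ ℓ') where
  module A = CommutativeRing A
  module F = CommutativeRing F
  field
    domain    : IsIntegralDomain A
    field′    : IsField F
    hom       : IsRingHomomorphism A.rawRing F.rawRing ι
    injective : Injective A._≈_ F._≈_ ι
    fractions : ∀ (f : F.Carrier) → ∃ λ a → ∃ λ b → ¬ (b A.≈ A.0#) × (f F.* ι b F.≈ ι a)

-- H_R = R^{2g} with symplectic basis a_1..a_g, b_1..b_g
-- (index i < g is a_{i}, index g + l is b_l).  Λ³ H_R is modelled as
-- alternating 3-tensors (the coefficient of e_i ∧ e_j ∧ e_k sits at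
-- (i,j,k), with signs for other orderings).

module Coords {c ℓ} (R : CommutativeRing c ℓ) (g : ℕ) where
  open CommutativeRing R using (Carrier; _≈_; _+_; _*_; -_; _-_; 0#; 1#; +-rawMonoid)

  Idx : Set
  Idx = Fin (g ℕ.+ g)

  H : Set c
  H = Idx → Carrier

  T3 : Set c
  T3 = Idx → Idx → Idx → Carrier

  Mat : Set c
  Mat = Idx → Idx → Carrier

  Σ[_] : (Idx → Carrier) → Carrier
  Σ[ f ] = Algebra.Definitions.RawMonoid.sum +-rawMonoid f
    where import Algebra.Definitions.RawMonoid

  _≈H_ : H → H → Set ℓ
  h ≈H h' = ∀ i → h i ≈ h' i

  _≈T_ : T3 → T3 → Set ℓ
  x ≈T y = ∀ i j k → x i j k ≈ y i j k

  0H : H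
  0H _ = 0#

  _+T_ : T3 → T3 → T3
  (x +T y) i j k = x i j k + y i j k

  _-T_ : T3 → T3 → T3
  (x -T y) i j k = x i j k - y i j k

  _·T_ : Carrier → T3 → T3
  (a ·T x) i j k = a * x i j k

  _·H_ : Carrier → H → H
  (a ·H h) i = a * h i

  _+H_ : H → H → H
  (h +H h') i = h i + h' i

  record Alt (x : T3) : Set ℓ where
    field
      swap₁₂ : ∀ i j k → x j i k ≈ - x i j k
      swap₂₃ : ∀ i j k → x i k j ≈ - x i j k
      diag   : ∀ i k → x i i k ≈ 0#

  -- Matrix J of the symplectic form (ω(a_l,b_l) = 1 = -ω(b_l,a_l));
  -- it is also the coefficient matrix of θ̌ = Σ a_l ∧ b_l ∈ Λ² H.
  J : Mat
  J i j with splitAt g i | splitAt g j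
  ... | inj₁ l | inj₂ l' = if does (l ≟ l') then 1# else 0#
  ... | inj₂ l | inj₁ l' = if does (l ≟ l') then - 1# else 0#
  ... | _      | _       = 0#

  θ∧ : H → T3
  θ∧ h i j k = J i j * h k + J j k * h i + J k i * h j

  actH : Mat → H → H
  actH M h i = Σ[ (λ a → M i a * h a) ]

  act3 : Mat → T3 → T3
  act3 M x i j k = Σ[ (λ a → Σ[ (λ b → Σ[ (λ d → M i a * M j b * M k d * x a b d) ]) ]) ]

  IsGSp : Mat → Carrier → Set (c ⊔ ℓ)
  IsGSp M m = (∀ i j → Σ[ (λ k → Σ[ (λ l → M k i * J k l * M l j) ]) ] ≈ m * J i j)
              × IsUnit R m

  -- A GSp(H_R)-equivariant retraction π : (Λ³ H_R)(-1) → H_R of h ↦ θ̌ ∧ h,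
  -- i.e. a GSp-equivariant splitting (Λ³H)(-1) = H ⊕ Λ³₀H (with Λ³₀H ≅ ker π).
  -- GSp acts on (Λ³H)(-1) by m⁻¹ · Λ³M.
  record IsEquivariantSplitting (π : T3 → H) : Set (c ⊔ ℓ) where
    field
      cong      : ∀ x y → Alt x → Alt y → x ≈T y → π x ≈H π y
      additive  : ∀ x y → Alt x → Alt y → π (x +T y) ≈H (π x +H π y)
      homog     : ∀ a x → Alt x → π (a ·T x) ≈H (a ·H π x)
      retract   : ∀ h → π (θ∧ h) ≈H h
      equivar   : ∀ M m m' → IsGSp M m → m * m' ≈ 1# → ∀ x → Alt x →
                  π (m' ·T act3 M x) ≈H actH M (π x)

  -- Λ³ₙ H_R.  Elements are represented as:
  --   n = 0     : a representative u ∈ Λ³H of its class ū in Λ³₀H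
  --   n = suc m : a tuple (u_1,…,u_n) ∈ (Λ³H)ⁿ
  Dom : ℕ → Set c
  Dom zero    = T3
  Dom (suc m) = Vector T3 (suc m)

  -- (u_1,…,u_n) ∈ Λ³ₙ H_R : all u_i alternating, all ū_i equal
  -- (i.e. u_i - u_j ∈ θ̌ ∧ H_R)
  InΛ3 : (n : ℕ) → Dom n → Set (c ⊔ ℓ)
  InΛ3 zero    u = Lift (c ⊔ ℓ) (Alt u)
  InΛ3 (suc m) u = (∀ i → Alt (u i)) ×
                   (∀ i j → ∃ λ (h : H) → (u i -T u j) ≈T θ∧ h)

  module Split (π : T3 → H) where
    -- Λ³ₙ H ≅ Λ³₀ H ⊕ Hⁿ  (the Λ³₀H-component given by a representative)
    toSplit : (n : ℕ) → Dom n → T3 × Vector H n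
    toSplit zero    u = u , λ ()
    toSplit (suc m) u = u zero , λ i → π (u i)

    fromSplit : (m : ℕ) → T3 × Vector H (suc m) → Vector T3 (suc m)
    fromSplit m (v , hs) i = (v -T θ∧ (π v)) +T θ∧ (hs i)

    ζ : (n : ℕ) → Dom n → Vector T3 (suc n)
    ζ n u = fromSplit n (proj₁ (toSplit n u) , (0H ∷ proj₂ (toSplit n u)))

module _ {c ℓ c' ℓ'} (A : CommutativeRing c ℓ) (F : CommutativeRing c' ℓ')
         (ι : CommutativeRing.Carrier A → CommutativeRing.Carrier F) (g : ℕ) where
  private
    module CA = Coords A g
    module CF = Coords F g

  mapT : CA.T3 → CF.T3
  mapT u i j k = ι (u i j k)

  mapDom : (n : ℕ) → CA.Dom n → CF.Dom n
  mapDom zero    u = mapT u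
  mapDom (suc m) u i = mapT (u i)

  InLattice : (m : ℕ) → Vector CF.T3 (suc m) → Set (c ⊔ ℓ ⊔ ℓ')
  InLattice m y = ∃ λ (u : CA.Dom (suc m)) → CA.InΛ3 (suc m) u ×
                    (∀ i → CF._≈T_ (mapT (u i)) (y i))

module Submission where

-- Let π be the GSp-equivariant retraction of h ↦ θ̌ ∧ h over F and let p
-- be the a_0-coordinate of π(a_1 ∧ b_1 ∧ a_0).  In θ̌ ∧ a_0 = Σ_l a_l ∧ b_l ∧ a_0
-- the l = 0 term vanishes, and equivariance under the symplectic permutation
-- matrices exchanging the pairs (a_l, b_l) and (a_1, b_1) shows that each of the
-- other g − 1 terms contributes p; so π(θ̌ ∧ a_0) = a_0 forces (g − 1)·p = 1.
-- For u = a_1 ∧ b_1 ∧ a_0 ∈ Λ³H_A the first component of ζ_n(u) is u − θ̌ ∧ π(u),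
-- whose a_2 ∧ b_2 ∧ a_0 coordinate is −p.  If ζ_n(u) were integral, then −p = ι(w)
-- with w ∈ A, and (g − 1)·(−w) = 1 would make g − 1 a unit.

open import Defs
open import Algebra.Bundles using (CommutativeRing)
open import Data.Nat.Base as ℕ using (ℕ; zero; suc; _≤_; _∸_; s≤s)
open import Data.Fin.Base using (Fin; zero; suc; punchIn; splitAt; join; _↑ˡ_; _↑ʳ_)
open import Data.Fin.Properties
  using ( _≟_; punchInᵢ≢i; splitAt-↑ˡ; splitAt-↑ʳ; splitAt-join; join-splitAt
        ; splitAt⁻¹-↑ˡ; splitAt⁻¹-↑ʳ; ↑ˡ-injective; ↑ʳ-injective)
open import Data.Sum.Base as Sum using (_⊎_; inj₁; inj₂)
open import Data.Sum.Properties using (map-map; map-cong; map-id)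
open import Data.Product.Base using (∃; _×_; _,_)
open import Level using (lift)
open import Data.Vec.Functional using (Vector)
open import Data.Bool.Base using (if_then_else_)
open import Relation.Nullary using (¬_; does; yes; no)
open import Relation.Nullary.Negation using (contradiction)
open import Relation.Binary.PropositionalEquality as ≡ using (_≡_; _≢_)
open import Function.Base using (id; _∘_)
import Data.Fin.Permutation.Components as Transposition
open Transposition using (transpose-inverse)
import Relation.Binary.Reasoning.Setoid as SetoidReasoning
open import Algebra.Morphism.Structures using (module RingMorphisms)

module RingFacts {c ℓ} (R : CommutativeRing c ℓ) where
  open CommutativeRing R hiding (zero)
  open SetoidReasoning setoid
  open import Algebra.Properties.Semiring.Sum semiring using (sum-cong-≋; sum-remove; sum-replicate-zero)
  open import Algebra.Properties.Semiring.Sum semiring public using (sum; ∑-distrib-+; *-distribʳ-sum)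
  open import Algebra.Properties.Ring ring using (-0#≈0#)

  left-zero : ∀ {x} y → x ≈ 0# → x * y ≈ 0#
  left-zero y x≈0 = trans (*-congʳ x≈0) (zeroˡ y)

  right-zero : ∀ x {y} → y ≈ 0# → x * y ≈ 0#
  right-zero x y≈0 = trans (*-congˡ y≈0) (zeroʳ x)

  difference-zero : ∀ {x y} → x ≈ 0# → y ≈ 0# → x - y ≈ 0#
  difference-zero x≈0 y≈0 = trans (+-cong x≈0 (trans (-‿cong y≈0) -0#≈0#)) (+-identityʳ 0#)

  δ : ∀ {n} → Fin n → Fin n → Carrier
  δ x y = if does (x ≟ y) then 1# else 0#

  δ-≡ : ∀ {n} {x y : Fin n} → x ≡ y → δ x y ≈ 1#
  δ-≡ {x = x} {y} x≡y with x ≟ y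
  ... | yes _   = refl
  ... | no x≢y  = contradiction x≡y x≢y

  δ-refl : ∀ {n} (x : Fin n) → δ x x ≈ 1#
  δ-refl x = δ-≡ {x = x} ≡.refl

  δ-≢ : ∀ {n} {x y : Fin n} → x ≢ y → δ x y ≈ 0#
  δ-≢ {x = x} {y} x≢y with x ≟ y
  ... | yes x≡y = contradiction x≡y x≢y
  ... | no _    = refl

  δ-iff : ∀ {m n} {x y : Fin m} {x' y' : Fin n} →
          (x ≡ y → x' ≡ y') → (x' ≡ y' → x ≡ y) → δ x y ≈ δ x' y'
  δ-iff {x = x} {y} to from with x ≟ y
  ... | yes x≡y = sym (δ-≡ (to x≡y))
  ... | no x≢y  = sym (δ-≢ (λ x'≡y' → x≢y (from x'≡y')))

  sum-cong : ∀ {n} (f f' : Vector Carrier n) → (∀ i → f i ≈ f' i) → sum f ≈ sum f'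
  sum-cong f f' f≈f' = sum-cong-≋ f≈f'

  sum-zero : ∀ {n} (f : Vector Carrier n) → (∀ i → f i ≈ 0#) → sum f ≈ 0#
  sum-zero {n} f f≈0 = trans (sum-cong-≋ f≈0) (sum-replicate-zero n)

  sum-select : ∀ {n} (f : Vector Carrier n) k → (∀ i → i ≢ k → f i ≈ 0#) → sum f ≈ f k
  sum-select {suc n} f k others = begin
    sum f                               ≈⟨ sum-remove f ⟩
    f k + sum (λ j → f (punchIn k j))   ≈⟨ +-congˡ rest≈0 ⟩
    f k + 0#                            ≈⟨ +-identityʳ (f k) ⟩
    f k                                 ∎
    where
    rest≈0 : sum (λ j → f (punchIn k j)) ≈ 0#
    rest≈0 = sum-zero _ (λ j → others (punchIn k j) (punchInᵢ≢i k j))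

  sum-δ : ∀ {n} (y : Fin n) (c : Carrier) (G : Vector Carrier n) →
          sum (λ d → (c * δ y d) * G d) ≈ c * G y
  sum-δ y c G = begin
    sum (λ d → (c * δ y d) * G d) ≈⟨ sum-select _ y off-y ⟩
    (c * δ y y) * G y             ≈⟨ *-congʳ (trans (*-congˡ (δ-refl y)) (*-identityʳ c)) ⟩
    c * G y                       ∎
    where
    off-y : ∀ d → d ≢ y → (c * δ y d) * G d ≈ 0#
    off-y d d≢y = left-zero (G d) (right-zero c (δ-≢ (λ y≡d → d≢y (≡.sym y≡d))))

  sum-δ₁ : ∀ {n} (y : Fin n) (G : Vector Carrier n) → sum (λ d → δ y d * G d) ≈ G y
  sum-δ₁ y G = begin
    sum (λ d → δ y d * G d)          ≈⟨ sum-cong _ _ (λ d → *-congʳ (sym (*-identityˡ (δ y d)))) ⟩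
    sum (λ d → (1# * δ y d) * G d)   ≈⟨ sum-δ y 1# G ⟩
    1# * G y                         ≈⟨ *-identityˡ (G y) ⟩
    G y                              ∎

  sum-const : ∀ n x → sum {n} (λ _ → x) ≈ natR R n * x
  sum-const zero    x = sym (zeroˡ x)
  sum-const (suc n) x = begin
    x + sum {n} (λ _ → x)    ≈⟨ +-cong (sym (*-identityˡ x)) (sum-const n x) ⟩
    1# * x + natR R n * x    ≈⟨ sym (distribʳ x 1# (natR R n)) ⟩
    (1# + natR R n) * x      ∎

module Antisymmetrisation {c ℓ} (R : CommutativeRing c ℓ) {X : Set} where
  open CommutativeRing R hiding (zero)
  open SetoidReasoning setoid
  open import Algebra.Properties.AbelianGroup +-abelianGroup using (⁻¹-anti-homo‿-; ⁻¹-∙-comm)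
  open import Algebra.Solver.CommutativeMonoid +-commutativeMonoid using (solve; _⊕_; _⊜_)

  Fun3 : Set c
  Fun3 = X → X → X → Carrier

  Ant : Fun3 → Fun3
  Ant f i j k = ((f i j k - f j i k) + (f j k i - f k j i)) + (f k i j - f i k j)

  private
    neg-sum₃ : ∀ p q r → - ((p + q) + r) ≈ (- p + - q) + - r
    neg-sum₃ p q r = trans (sym (⁻¹-∙-comm (p + q) r)) (+-congʳ (sym (⁻¹-∙-comm p q)))

    swap-last : ∀ p q r → (p + q) + r ≈ (p + r) + q
    swap-last = solve 3 (λ p q r → (p ⊕ q) ⊕ r ⊜ (p ⊕ r) ⊕ q) refl

    reverse₃ : ∀ p q r → (p + q) + r ≈ (r + q) + p
    reverse₃ = solve 3 (λ p q r → (p ⊕ q) ⊕ r ⊜ (r ⊕ q) ⊕ p) refl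

    cancel₃ : ∀ x y z → ((x - y) + (z - x)) + (y - z) ≈ 0#
    cancel₃ x y z = begin
      ((x - y) + (z - x)) + (y - z)
        ≈⟨ solve 6 (λ x x' y y' z z' → ((x ⊕ y') ⊕ (z ⊕ x')) ⊕ (y ⊕ z') ⊜ (x ⊕ x') ⊕ ((y ⊕ y') ⊕ (z ⊕ z')))
                   refl x (- x) y (- y) z (- z) ⟩
      (x - x) + ((y - y) + (z - z))
        ≈⟨ +-cong (-‿inverseʳ x) (+-cong (-‿inverseʳ y) (-‿inverseʳ z)) ⟩
      0# + (0# + 0#)
        ≈⟨ trans (+-identityˡ _) (+-identityˡ 0#) ⟩
      0# ∎

  neg-Ant : ∀ f i j k →
            - Ant f i j k ≈ ((f j i k - f i j k) + (f k j i - f j k i)) + (f i k j - f k i j)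
  neg-Ant f i j k = trans (neg-sum₃ _ _ _)
    (+-cong (+-cong (⁻¹-anti-homo‿- _ _) (⁻¹-anti-homo‿- _ _)) (⁻¹-anti-homo‿- _ _))

  Ant-swap₁₂ : ∀ f i j k → Ant f j i k ≈ - Ant f i j k
  Ant-swap₁₂ f i j k = sym (trans (neg-Ant f i j k) (swap-last _ _ _))

  Ant-swap₂₃ : ∀ f i j k → Ant f i k j ≈ - Ant f i j k
  Ant-swap₂₃ f i j k = sym (trans (neg-Ant f i j k) (reverse₃ _ _ _))

  Ant-diag : ∀ f i k → Ant f i i k ≈ 0#
  Ant-diag f i k = begin
    ((p - p) + (q - r)) + (r - q)     ≈⟨ +-cong (+-congʳ (-‿inverseʳ p)) (sym (⁻¹-anti-homo‿- q r)) ⟩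
    (0# + (q - r)) - (q - r)          ≈⟨ trans (+-congʳ (+-identityˡ _)) (-‿inverseʳ (q - r)) ⟩
    0#                                ∎
    where
    p = f i i k
    q = f i k i
    r = f k i i

  Ant-cong : ∀ f f' → (∀ i j k → f i j k ≈ f' i j k) → ∀ i j k → Ant f i j k ≈ Ant f' i j k
  Ant-cong f f' f≈f' i j k =
    +-cong (+-cong (−-cong (f≈f' i j k) (f≈f' j i k)) (−-cong (f≈f' j k i) (f≈f' k j i)))
           (−-cong (f≈f' k i j) (f≈f' i k j))
    where
    −-cong : ∀ {x y x' y'} → x ≈ x' → y ≈ y' → x - y ≈ x' - y'
    −-cong x≈x' y≈y' = +-cong x≈x' (-‿cong y≈y')

  Ant-sym₁₃ : ∀ f → (∀ i j k → f i j k ≈ f k j i) → ∀ i j k → Ant f i j k ≈ 0#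
  Ant-sym₁₃ f sym₁₃ i j k = begin
    ((f i j k - f j i k) + (f j k i - f k j i)) + (f k i j - f i k j)
      ≈⟨ +-cong (+-congˡ (+-congˡ (-‿cong (sym (sym₁₃ i j k)))))
                (+-cong (sym (sym₁₃ j i k)) (-‿cong (sym (sym₁₃ j k i)))) ⟩
    ((f i j k - f j i k) + (f j k i - f i j k)) + (f j i k - f j k i)
      ≈⟨ cancel₃ (f i j k) (f j i k) (f j k i) ⟩
    0# ∎

transpose-source : ∀ {n} (i j : Fin n) → Transposition.transpose i j i ≡ j
transpose-source i j with i ≟ i
... | yes _   = ≡.refl
... | no i≢i  = contradiction ≡.refl i≢i

transpose-other : ∀ {n} (i j k : Fin n) → k ≢ i → k ≢ j → Transposition.transpose i j k ≡ k
transpose-other i j k k≢i k≢j with k ≟ i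
... | yes k≡i = contradiction k≡i k≢i
... | no _ with k ≟ j
...   | yes k≡j = contradiction k≡j k≢j
...   | no _    = ≡.refl

module SymplecticIndices (g : ℕ) where

  a b : Fin g → Fin (g ℕ.+ g)
  a m = m ↑ˡ g
  b m = g ↑ʳ m

  a-or-b : ∀ i → (∃ λ m → i ≡ a m) ⊎ (∃ λ m → i ≡ b m)
  a-or-b i with splitAt g i in eq
  ... | inj₁ m = inj₁ (m , ≡.sym (splitAt⁻¹-↑ˡ eq))
  ... | inj₂ m = inj₂ (m , ≡.sym (splitAt⁻¹-↑ʳ eq))

  a≢b : ∀ m m' → a m ≢ b m'
  a≢b m m' am≡bm' with ≡.trans (≡.sym (splitAt-↑ˡ g m g)) (≡.trans (≡.cong (splitAt g) am≡bm') (splitAt-↑ʳ g g m'))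
  ... | ()

  a-injective : ∀ {m m'} → a m ≡ a m' → m ≡ m'
  a-injective = ↑ˡ-injective g _ _

  b-injective : ∀ {m m'} → b m ≡ b m' → m ≡ m'
  b-injective = ↑ʳ-injective g _ _

  a-distinct : ∀ {m m'} → m ≢ m' → a m ≢ a m'
  a-distinct m≢m' am≡am' = m≢m' (a-injective am≡am')

  liftPairs : (Fin g → Fin g) → Fin (g ℕ.+ g) → Fin (g ℕ.+ g)
  liftPairs f i = join g g (Sum.map f f (splitAt g i))

  liftPairs-a : ∀ f m → liftPairs f (a m) ≡ a (f m)
  liftPairs-a f m rewrite splitAt-↑ˡ g m g = ≡.refl

  liftPairs-b : ∀ f m → liftPairs f (b m) ≡ b (f m)
  liftPairs-b f m rewrite splitAt-↑ʳ g g m = ≡.refl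

  liftPairs-inverse : ∀ f f' → (∀ m → f (f' m) ≡ m) → ∀ i → liftPairs f (liftPairs f' i) ≡ i
  liftPairs-inverse f f' f∘f' i = begin
    join g g (Sum.map f f (splitAt g (join g g (Sum.map f' f' (splitAt g i)))))
      ≡⟨ ≡.cong (join g g ∘ Sum.map f f) (splitAt-join g g (Sum.map f' f' (splitAt g i))) ⟩
    join g g (Sum.map f f (Sum.map f' f' (splitAt g i)))
      ≡⟨ ≡.cong (join g g) (≡.trans (map-map (splitAt g i)) (map-cong f∘f' f∘f' (splitAt g i))) ⟩
    join g g (Sum.map id id (splitAt g i))
      ≡⟨ ≡.cong (join g g) (map-id (splitAt g i)) ⟩
    join g g (splitAt g i)
      ≡⟨ join-splitAt g g i ⟩
    i ∎
    where open ≡.≡-Reasoning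

module SymplecticBasis {c ℓ} (R : CommutativeRing c ℓ) (g : ℕ) where
  open CommutativeRing R hiding (zero)
  open SetoidReasoning setoid
  open RingFacts R
  open Coords R g
  open Antisymmetrisation R {Idx}
  open SymplecticIndices g
  open import Algebra.Properties.Ring ring using (-0#≈0#; -‿distribˡ-*)
  open import Algebra.Properties.AbelianGroup +-abelianGroup using (⁻¹-∙-comm)

  J-ab : ∀ m m' → J (a m) (b m') ≡ δ m m'
  J-ab m m' rewrite splitAt-↑ˡ g m g | splitAt-↑ʳ g g m' = ≡.refl

  J-ba : ∀ m m' → J (b m) (a m') ≈ - δ m m'
  J-ba m m' rewrite splitAt-↑ʳ g g m | splitAt-↑ˡ g m' g with m ≟ m'
  ... | yes _ = refl
  ... | no _  = sym -0#≈0#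

  J-aa : ∀ m m' → J (a m) (a m') ≡ 0#
  J-aa m m' rewrite splitAt-↑ˡ g m g | splitAt-↑ˡ g m' g = ≡.refl

  J-bb : ∀ m m' → J (b m) (b m') ≡ 0#
  J-bb m m' rewrite splitAt-↑ʳ g g m | splitAt-↑ʳ g g m' = ≡.refl

  δab : ∀ m m' → δ (a m) (b m') ≈ 0#
  δab m m' = δ-≢ (a≢b m m')

  δba : ∀ m m' → δ (b m) (a m') ≈ 0#
  δba m m' = δ-≢ (λ bm≡am' → a≢b m' m (≡.sym bm≡am'))

  θ-coeff : Idx → Idx → Fin g → Carrier
  θ-coeff i j l = δ i (a l) * δ j (b l) - δ j (a l) * δ i (b l)

  J-expansion : ∀ i j → J i j ≈ sum (θ-coeff i j)
  J-expansion i j with a-or-b i | a-or-b j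
  ... | inj₁ (m , ≡.refl) | inj₁ (m' , ≡.refl) = begin
    J (a m) (a m')              ≡⟨ J-aa m m' ⟩
    0#                          ≈⟨ sym (sum-zero _ each-zero) ⟩
    sum (θ-coeff (a m) (a m'))  ∎
    where
    each-zero : ∀ l → θ-coeff (a m) (a m') l ≈ 0#
    each-zero l = difference-zero (right-zero _ (δab m' l)) (right-zero _ (δab m l))
  ... | inj₂ (m , ≡.refl) | inj₂ (m' , ≡.refl) = begin
    J (b m) (b m')              ≡⟨ J-bb m m' ⟩
    0#                          ≈⟨ sym (sum-zero _ each-zero) ⟩
    sum (θ-coeff (b m) (b m'))  ∎
    where
    each-zero : ∀ l → θ-coeff (b m) (b m') l ≈ 0#
    each-zero l = difference-zero (left-zero _ (δba m l)) (left-zero _ (δba m' l))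
  ... | inj₁ (m , ≡.refl) | inj₂ (m' , ≡.refl) = sym (begin
    sum (θ-coeff (a m) (b m'))
      ≈⟨ sum-select _ m (λ l l≢m → difference-zero (left-zero _ (δ-≢ (a-distinct (λ m≡l → l≢m (≡.sym m≡l)))))
                                                    (left-zero _ (δba m' l))) ⟩
    δ (a m) (a m) * δ (b m') (b m) - δ (b m') (a m) * δ (a m) (b m)
      ≈⟨ +-cong (*-congʳ (δ-refl (a m))) (-‿cong (left-zero _ (δba m' m))) ⟩
    1# * δ (b m') (b m) - 0#     ≈⟨ trans (+-cong (*-identityˡ _) -0#≈0#) (+-identityʳ _) ⟩
    δ (b m') (b m)               ≈⟨ δ-iff (λ bm'≡bm → ≡.sym (b-injective bm'≡bm)) (λ m≡m' → ≡.cong b (≡.sym m≡m')) ⟩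
    δ m m'                       ≡⟨ ≡.sym (J-ab m m') ⟩
    J (a m) (b m')               ∎)
  ... | inj₂ (m , ≡.refl) | inj₁ (m' , ≡.refl) = sym (begin
    sum (θ-coeff (b m) (a m'))
      ≈⟨ sum-select _ m' (λ l l≢m' → difference-zero (left-zero _ (δba m l))
                                                      (left-zero _ (δ-≢ (a-distinct (λ m'≡l → l≢m' (≡.sym m'≡l)))))) ⟩
    δ (b m) (a m') * δ (a m') (b m') - δ (a m') (a m') * δ (b m) (b m')
      ≈⟨ +-cong (left-zero _ (δba m m')) (-‿cong (*-congʳ (δ-refl (a m')))) ⟩
    0# - 1# * δ (b m) (b m')     ≈⟨ trans (+-identityˡ _) (-‿cong (*-identityˡ _)) ⟩
    - δ (b m) (b m')             ≈⟨ -‿cong (δ-iff b-injective (≡.cong b)) ⟩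
    - δ m m'                     ≈⟨ sym (J-ba m m') ⟩
    J (b m) (a m')               ∎)

  liftPairs-J : ∀ f → (∀ {m m'} → f m ≡ f m' → m ≡ m') →
                ∀ i j → J (liftPairs f i) (liftPairs f j) ≈ J i j
  liftPairs-J f f-injective i j with a-or-b i | a-or-b j
  ... | inj₁ (m , ≡.refl) | inj₁ (m' , ≡.refl)
    rewrite liftPairs-a f m | liftPairs-a f m' | J-aa (f m) (f m') | J-aa m m' = refl
  ... | inj₂ (m , ≡.refl) | inj₂ (m' , ≡.refl)
    rewrite liftPairs-b f m | liftPairs-b f m' | J-bb (f m) (f m') | J-bb m m' = refl
  ... | inj₁ (m , ≡.refl) | inj₂ (m' , ≡.refl)
    rewrite liftPairs-a f m | liftPairs-b f m' | J-ab (f m) (f m') | J-ab m m' = δ-iff f-injective (≡.cong f)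
  ... | inj₂ (m , ≡.refl) | inj₁ (m' , ≡.refl)
    rewrite liftPairs-b f m | liftPairs-a f m' =
      trans (J-ba (f m) (f m')) (trans (-‿cong (δ-iff f-injective (≡.cong f))) (sym (J-ba m m')))

  0T : T3
  0T _ _ _ = 0#

  sumT : ∀ {n} → (Fin n → T3) → T3
  sumT xs i j k = sum (λ l → xs l i j k)

  Alt-resp : ∀ {x y} → x ≈T y → Alt y → Alt x
  Alt-resp x≈y alt-y = record
    { swap₁₂ = λ i j k → trans (x≈y j i k) (trans (Alt.swap₁₂ alt-y i j k) (-‿cong (sym (x≈y i j k))))
    ; swap₂₃ = λ i j k → trans (x≈y i k j) (trans (Alt.swap₂₃ alt-y i j k) (-‿cong (sym (x≈y i j k))))
    ; diag   = λ i k → trans (x≈y i i k) (Alt.diag alt-y i k)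
    }

  Alt-0T : Alt 0T
  Alt-0T = record { swap₁₂ = λ _ _ _ → sym -0#≈0# ; swap₂₃ = λ _ _ _ → sym -0#≈0# ; diag = λ _ _ → refl }

  Alt-+T : ∀ {x y} → Alt x → Alt y → Alt (x +T y)
  Alt-+T alt-x alt-y = record
    { swap₁₂ = λ i j k → trans (+-cong (Alt.swap₁₂ alt-x i j k) (Alt.swap₁₂ alt-y i j k)) (⁻¹-∙-comm _ _)
    ; swap₂₃ = λ i j k → trans (+-cong (Alt.swap₂₃ alt-x i j k) (Alt.swap₂₃ alt-y i j k)) (⁻¹-∙-comm _ _)
    ; diag   = λ i k → trans (+-cong (Alt.diag alt-x i k) (Alt.diag alt-y i k)) (+-identityʳ 0#)
    }

  Alt-sumT : ∀ {n} (xs : Fin n → T3) → (∀ l → Alt (xs l)) → Alt (sumT xs)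
  Alt-sumT {zero}  xs alt = Alt-0T
  Alt-sumT {suc n} xs alt = Alt-+T (alt zero) (Alt-sumT (λ l → xs (suc l)) (λ l → alt (suc l)))

  _⊗_⊗_ : Idx → Idx → Idx → T3
  (x ⊗ y ⊗ z) i j k = (δ i x * δ j y) * δ k z

  _∧_∧_ : Idx → Idx → Idx → T3
  x ∧ y ∧ z = Ant (x ⊗ y ⊗ z)

  Alt-∧ : ∀ x y z → Alt (x ∧ y ∧ z)
  Alt-∧ x y z = record
    { swap₁₂ = Ant-swap₁₂ (x ⊗ y ⊗ z) ; swap₂₃ = Ant-swap₂₃ (x ⊗ y ⊗ z) ; diag = Ant-diag (x ⊗ y ⊗ z) }

  ∧-≡ : ∀ {x x' y y' z z'} → x ≡ x' → y ≡ y' → z ≡ z' → (x ∧ y ∧ z) ≈T (x' ∧ y' ∧ z')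
  ∧-≡ ≡.refl ≡.refl ≡.refl _ _ _ = refl

  ∧-repeated : ∀ x y → (x ∧ y ∧ x) ≈T 0T
  ∧-repeated x y = Ant-sym₁₃ (x ⊗ y ⊗ x) outer-symmetric
    where
    outer-symmetric : ∀ i j k → (x ⊗ y ⊗ x) i j k ≈ (x ⊗ y ⊗ x) k j i
    outer-symmetric i j k = begin
      (δ i x * δ j y) * δ k x   ≈⟨ *-comm _ _ ⟩
      δ k x * (δ i x * δ j y)   ≈⟨ *-congˡ (*-comm _ _) ⟩
      δ k x * (δ j y * δ i x)   ≈⟨ sym (*-assoc _ _ _) ⟩
      (δ k x * δ j y) * δ i x   ∎

  ∧-coordinate-zero : ∀ x y z i j k → i ≢ x → j ≢ x → k ≢ x → (x ∧ y ∧ z) i j k ≈ 0#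
  ∧-coordinate-zero x y z i j k i≢x j≢x k≢x = begin
    ((t i j k - t j i k) + (t j k i - t k j i)) + (t k i j - t i k j)
      ≈⟨ +-cong (+-cong (difference-zero (t-zero i j k i≢x) (t-zero j i k j≢x))
                        (difference-zero (t-zero j k i j≢x) (t-zero k j i k≢x)))
                (difference-zero (t-zero k i j k≢x) (t-zero i k j i≢x)) ⟩
    (0# + 0#) + 0#    ≈⟨ trans (+-identityʳ _) (+-identityʳ 0#) ⟩
    0#                ∎
    where
    t = x ⊗ y ⊗ z
    t-zero : ∀ p q r → p ≢ x → t p q r ≈ 0#
    t-zero p q r p≢x = left-zero _ (left-zero _ (δ-≢ p≢x))

  basis : Idx → H
  basis r i = δ i r

  θ∧-basis : ∀ r → θ∧ (basis r) ≈T sumT (λ l → a l ∧ b l ∧ r)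
  θ∧-basis r i j k = begin
    (J i j * h k + J j k * h i) + J k i * h j
      ≈⟨ +-cong (+-cong (expand i j k) (expand j k i)) (expand k i j) ⟩
    (sum (λ l → θ-coeff i j l * h k) + sum (λ l → θ-coeff j k l * h i)) + sum (λ l → θ-coeff k i l * h j)
      ≈⟨ +-congʳ (sym (∑-distrib-+ (λ l → θ-coeff i j l * h k) (λ l → θ-coeff j k l * h i))) ⟩
    sum (λ l → θ-coeff i j l * h k + θ-coeff j k l * h i) + sum (λ l → θ-coeff k i l * h j)
      ≈⟨ sym (∑-distrib-+ (λ l → θ-coeff i j l * h k + θ-coeff j k l * h i) (λ l → θ-coeff k i l * h j)) ⟩
    sum (λ l → (θ-coeff i j l * h k + θ-coeff j k l * h i) + θ-coeff k i l * h j)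
      ≈⟨ sum-cong _ (λ l → (a l ∧ b l ∧ r) i j k) distribute ⟩
    sumT (λ l → a l ∧ b l ∧ r) i j k ∎
    where
    h = basis r
    expand : ∀ p q s → J p q * h s ≈ sum (λ l → θ-coeff p q l * h s)
    expand p q s = trans (*-congʳ (J-expansion p q)) (*-distribʳ-sum (h s) (θ-coeff p q))
    sub-distribʳ : ∀ x y z → (x - y) * z ≈ x * z - y * z
    sub-distribʳ x y z = trans (distribʳ z x (- y)) (+-congˡ (sym (-‿distribˡ-* y z)))
    distribute : ∀ l → (θ-coeff i j l * h k + θ-coeff j k l * h i) + θ-coeff k i l * h j ≈ (a l ∧ b l ∧ r) i j k
    distribute l = +-cong (+-cong (sub-distribʳ _ _ _) (sub-distribʳ _ _ _)) (sub-distribʳ _ _ _)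

  θ∧-zero : θ∧ 0H ≈T 0T
  θ∧-zero i j k = trans (+-cong (+-cong (zeroʳ _) (zeroʳ _)) (zeroʳ _)) (trans (+-identityʳ _) (+-identityʳ 0#))

  θ∧-coordinate : ∀ q m z → z ≢ m → θ∧ q (a m) (b m) (a z) ≈ q (a z)
  θ∧-coordinate q m z z≢m = begin
    (J (a m) (b m) * q (a z) + J (b m) (a z) * q (a m)) + J (a z) (a m) * q (b m)
      ≈⟨ +-cong (+-cong (*-congʳ (trans (reflexive (J-ab m m)) (δ-refl m)))
                        (left-zero _ (trans (J-ba m z) (trans (-‿cong (δ-≢ (λ m≡z → z≢m (≡.sym m≡z)))) -0#≈0#))))
                (left-zero _ (reflexive (J-aa z m))) ⟩
    (1# * q (a z) + 0#) + 0#
      ≈⟨ trans (+-identityʳ _) (trans (+-identityʳ _) (*-identityˡ _)) ⟩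
    q (a z) ∎

module SymplecticPermutation {c ℓ} (R : CommutativeRing c ℓ) (g : ℕ)
    (σ σ⁻¹ : Fin (g ℕ.+ g) → Fin (g ℕ.+ g))
    (σ∘σ⁻¹ : ∀ i → σ (σ⁻¹ i) ≡ i) (σ⁻¹∘σ : ∀ i → σ⁻¹ (σ i) ≡ i)
    (J-invariant : ∀ i j → CommutativeRing._≈_ R (Coords.J R g (σ i) (σ j)) (Coords.J R g i j)) where
  open CommutativeRing R hiding (zero)
  open SetoidReasoning setoid
  open RingFacts R
  open Coords R g
  open SymplecticBasis R g using (_⊗_⊗_; _∧_∧_; Alt-resp)
  open Antisymmetrisation R using (Ant-cong)

  P : Mat
  P i j = δ (σ i) j

  σ-shift : ∀ {i j} → σ i ≡ j → i ≡ σ⁻¹ j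
  σ-shift {i} σi≡j = ≡.trans (≡.sym (σ⁻¹∘σ i)) (≡.cong σ⁻¹ σi≡j)

  δ-transfer : ∀ i j → δ (σ i) j ≈ δ i (σ⁻¹ j)
  δ-transfer i j = δ-iff σ-shift (λ i≡σ⁻¹j → ≡.trans (≡.cong σ i≡σ⁻¹j) (σ∘σ⁻¹ j))

  reindex : T3 → T3
  reindex x i j k = x (σ i) (σ j) (σ k)

  Alt-reindex : ∀ {x} → Alt x → Alt (reindex x)
  Alt-reindex alt = record
    { swap₁₂ = λ i j k → Alt.swap₁₂ alt (σ i) (σ j) (σ k)
    ; swap₂₃ = λ i j k → Alt.swap₂₃ alt (σ i) (σ j) (σ k)
    ; diag   = λ i k → Alt.diag alt (σ i) (σ k)
    }

  actH-P : ∀ h i → actH P h i ≈ h (σ i)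
  actH-P h i = sum-δ₁ (σ i) h

  act3-P : ∀ x → act3 P x ≈T reindex x
  act3-P x i j k = begin
    sum (λ p → sum (λ q → sum (λ r → ((P i p * P j q) * P k r) * x p q r)))
      ≈⟨ sum-cong _ _ (λ p → sum-cong _ _ (λ q → sum-δ (σ k) (P i p * P j q) (x p q))) ⟩
    sum (λ p → sum (λ q → (P i p * P j q) * x p q (σ k)))
      ≈⟨ sum-cong _ _ (λ p → sum-δ (σ j) (P i p) (λ q → x p q (σ k))) ⟩
    sum (λ p → P i p * x p (σ j) (σ k))
      ≈⟨ sum-δ₁ (σ i) (λ p → x p (σ j) (σ k)) ⟩
    x (σ i) (σ j) (σ k) ∎

  P-symplectic : IsGSp P 1#
  P-symplectic = preserves-J , (1# , *-identityˡ 1#)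
    where
    preserves-J : ∀ i j → sum (λ k → sum (λ l → (P k i * J k l) * P l j)) ≈ 1# * J i j
    preserves-J i j = begin
      sum (λ k → sum (λ l → (P k i * J k l) * P l j))
        ≈⟨ sum-cong _ (λ k → P k i * J k (σ⁻¹ j)) inner ⟩
      sum (λ k → δ (σ k) i * J k (σ⁻¹ j))
        ≈⟨ sum-select _ (σ⁻¹ i) (λ k k≢σ⁻¹i → left-zero _ (δ-≢ (λ σk≡i → k≢σ⁻¹i (σ-shift σk≡i)))) ⟩
      δ (σ (σ⁻¹ i)) i * J (σ⁻¹ i) (σ⁻¹ j)
        ≈⟨ *-cong (δ-≡ (σ∘σ⁻¹ i)) (sym (J-invariant (σ⁻¹ i) (σ⁻¹ j))) ⟩
      1# * J (σ (σ⁻¹ i)) (σ (σ⁻¹ j))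
        ≡⟨ ≡.cong₂ (λ p q → 1# * J p q) (σ∘σ⁻¹ i) (σ∘σ⁻¹ j) ⟩
      1# * J i j ∎
      where
      inner : ∀ k → sum (λ l → (P k i * J k l) * P l j) ≈ P k i * J k (σ⁻¹ j)
      inner k = begin
        sum (λ l → (P k i * J k l) * P l j)
          ≈⟨ sum-select _ (σ⁻¹ j) (λ l l≢σ⁻¹j → right-zero _ (δ-≢ (λ σl≡j → l≢σ⁻¹j (σ-shift σl≡j)))) ⟩
        (P k i * J k (σ⁻¹ j)) * δ (σ (σ⁻¹ j)) j
          ≈⟨ trans (*-congˡ (δ-≡ (σ∘σ⁻¹ j))) (*-identityʳ _) ⟩
        P k i * J k (σ⁻¹ j) ∎


  ∧-reindex : ∀ x y z → reindex (x ∧ y ∧ z) ≈T (σ⁻¹ x ∧ σ⁻¹ y ∧ σ⁻¹ z)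
  ∧-reindex x y z = Ant-cong (reindex (x ⊗ y ⊗ z)) (σ⁻¹ x ⊗ σ⁻¹ y ⊗ σ⁻¹ z)
    (λ i j k → *-cong (*-cong (δ-transfer i x) (δ-transfer j y)) (δ-transfer k z))

  π-reindex : ∀ π → IsEquivariantSplitting π → ∀ x → Alt x → ∀ i → π (reindex x) i ≈ π x (σ i)
  π-reindex π split x alt i = begin
    π (reindex x) i           ≈⟨ cong (reindex x) (1# ·T act3 P x) (Alt-reindex alt) alt-action as-action i ⟩
    π (1# ·T act3 P x) i      ≈⟨ equivar P 1# 1# P-symplectic (*-identityˡ 1#) x alt i ⟩
    actH P (π x) i            ≈⟨ actH-P (π x) i ⟩
    π x (σ i)                 ∎
    where
    open IsEquivariantSplitting split
    as-action : reindex x ≈T (1# ·T act3 P x)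
    as-action i j k = sym (trans (*-identityˡ _) (act3-P x i j k))
    alt-action : Alt (1# ·T act3 P x)
    alt-action = Alt-resp (λ i j k → sym (as-action i j k)) (Alt-reindex alt)

module EquivariantRetraction {c ℓ} (R : CommutativeRing c ℓ) (g : ℕ)
    (π : Coords.T3 R g → Coords.H R g) (split : Coords.IsEquivariantSplitting R g π) where
  open CommutativeRing R hiding (zero)
  open SetoidReasoning setoid
  open RingFacts R
  open Coords R g
  open SymplecticIndices g
  open SymplecticBasis R g
  open IsEquivariantSplitting split

  π-0T : π 0T ≈H 0H
  π-0T i = begin
    π 0T i          ≈⟨ cong 0T (0# ·T 0T) Alt-0T (Alt-resp zero≈0·0 Alt-0T) (λ i j k → sym (zero≈0·0 i j k)) i ⟩
    π (0# ·T 0T) i  ≈⟨ homog 0# 0T Alt-0T i ⟩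
    0# * π 0T i     ≈⟨ zeroˡ _ ⟩
    0#              ∎
    where
    zero≈0·0 : (0# ·T 0T) ≈T 0T
    zero≈0·0 _ _ _ = zeroˡ 0#

  π-vanishing : ∀ x → Alt x → x ≈T 0T → π x ≈H 0H
  π-vanishing x alt x≈0 i = trans (cong x 0T alt Alt-0T x≈0 i) (π-0T i)

  π-sumT : ∀ {n} (xs : Fin n → T3) → (∀ l → Alt (xs l)) → π (sumT xs) ≈H (λ i → sum (λ l → π (xs l) i))
  π-sumT {zero}  xs alt = π-0T
  π-sumT {suc n} xs alt i = begin
    π (xs zero +T sumT (λ l → xs (suc l))) i
      ≈⟨ additive (xs zero) (sumT (λ l → xs (suc l))) (alt zero) (Alt-sumT _ (λ l → alt (suc l))) i ⟩
    π (xs zero) i + π (sumT (λ l → xs (suc l))) i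
      ≈⟨ +-congˡ (π-sumT (λ l → xs (suc l)) (λ l → alt (suc l)) i) ⟩
    π (xs zero) i + sum (λ l → π (xs (suc l)) i) ∎

  -- By equivariance under the permutation of symplectic pairs swapping l and l',
  -- the a_z-coordinate of π(a_l ∧ b_l ∧ a_z) is the same for every pair l ≠ z.
  pair-independence : ∀ z l l' → l ≢ z → l' ≢ z →
                      π (a l ∧ b l ∧ a z) (a z) ≈ π (a l' ∧ b l' ∧ a z) (a z)
  pair-independence z l l' l≢z l'≢z = begin
    π (a l ∧ b l ∧ a z) (a z)
      ≈⟨ cong _ _ (Alt-∧ _ _ _) (S.Alt-reindex (Alt-∧ _ _ _)) (λ i j k → sym (reindexed i j k)) (a z) ⟩
    π (S.reindex (a l' ∧ b l' ∧ a z)) (a z)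
      ≈⟨ S.π-reindex π split _ (Alt-∧ _ _ _) (a z) ⟩
    π (a l' ∧ b l' ∧ a z) (σ (a z))
      ≡⟨ ≡.cong (π (a l' ∧ b l' ∧ a z)) (≡.trans (liftPairs-a τ z) (≡.cong a (transpose-other l l' z z≢l z≢l'))) ⟩
    π (a l' ∧ b l' ∧ a z) (a z) ∎
    where
    z≢l : z ≢ l
    z≢l z≡l = l≢z (≡.sym z≡l)
    z≢l' : z ≢ l'
    z≢l' z≡l' = l'≢z (≡.sym z≡l')
    τ τ⁻¹ : Fin g → Fin g
    τ   = Transposition.transpose l l'
    τ⁻¹ = Transposition.transpose l' l
    τ-injective : ∀ {m m'} → τ m ≡ τ m' → m ≡ m'
    τ-injective {m} {m'} τm≡τm' =
      ≡.trans (≡.sym (transpose-inverse l' l)) (≡.trans (≡.cong τ⁻¹ τm≡τm') (transpose-inverse l' l))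
    σ σ⁻¹ : Idx → Idx
    σ   = liftPairs τ
    σ⁻¹ = liftPairs τ⁻¹
    module S = SymplecticPermutation R g σ σ⁻¹
      (liftPairs-inverse τ τ⁻¹ (λ _ → transpose-inverse l l'))
      (liftPairs-inverse τ⁻¹ τ (λ _ → transpose-inverse l' l))
      (liftPairs-J τ τ-injective)
    reindexed : S.reindex (a l' ∧ b l' ∧ a z) ≈T (a l ∧ b l ∧ a z)
    reindexed i j k = trans (S.∧-reindex (a l') (b l') (a z) i j k)
      (∧-≡ (≡.trans (liftPairs-a τ⁻¹ l') (≡.cong a (transpose-source l' l)))
           (≡.trans (liftPairs-b τ⁻¹ l') (≡.cong b (transpose-source l' l)))
           (≡.trans (liftPairs-a τ⁻¹ z) (≡.cong a (transpose-other l' l z z≢l' z≢l))) i j k)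

module RetractionIdentity {c ℓ} (R : CommutativeRing c ℓ) (g' : ℕ)
    (π : Coords.T3 R (suc (suc g')) → Coords.H R (suc (suc g')))
    (split : Coords.IsEquivariantSplitting R (suc (suc g')) π) where
  open CommutativeRing R hiding (zero)
  open SetoidReasoning setoid
  open RingFacts R
  open Coords R (suc (suc g'))
  open SymplecticIndices (suc (suc g'))
  open SymplecticBasis R (suc (suc g'))
  open EquivariantRetraction R (suc (suc g')) π split
  open IsEquivariantSplitting split

  p : Carrier
  p = π (a (suc zero) ∧ b (suc zero) ∧ a zero) (a zero)

  retraction-identity : natR R (suc g') * p ≈ 1#
  retraction-identity = sym (begin
    1#                                      ≈⟨ sym (δ-refl (a zero)) ⟩
    basis (a zero) (a zero)                 ≈⟨ sym (retract (basis (a zero)) (a zero)) ⟩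
    π (θ∧ (basis (a zero))) (a zero)        ≈⟨ cong _ _ (Alt-resp (θ∧-basis (a zero)) Alt-terms) Alt-terms (θ∧-basis (a zero)) (a zero) ⟩
    π (sumT terms) (a zero)                 ≈⟨ π-sumT terms (λ l → Alt-∧ _ _ _) (a zero) ⟩
    π (terms zero) (a zero) + sum (λ l → π (terms (suc l)) (a zero))
      ≈⟨ +-cong (π-vanishing (terms zero) (Alt-∧ _ _ _) (∧-repeated (a zero) (b zero)) (a zero))
                (sum-cong _ (λ _ → p) (λ l → pair-independence zero (suc l) (suc zero) (λ ()) (λ ()))) ⟩
    0# + sum {suc g'} (λ _ → p)            ≈⟨ +-identityˡ _ ⟩
    sum {suc g'} (λ _ → p)                 ≈⟨ sum-const (suc g') p ⟩
    natR R (suc g') * p                     ∎)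
    where
    terms : Fin (suc (suc g')) → T3
    terms l = a l ∧ b l ∧ a zero
    Alt-terms : Alt (sumT terms)
    Alt-terms = Alt-sumT terms (λ l → Alt-∧ _ _ _)

module Obstruction {c ℓ c' ℓ'} (A : CommutativeRing c ℓ) (F : CommutativeRing c' ℓ')
    (ι : CommutativeRing.Carrier A → CommutativeRing.Carrier F) (ff : IsFractionField A F ι) (g' : ℕ)
    (π : Coords.T3 F (suc (suc (suc g'))) → Coords.H F (suc (suc (suc g'))))
    (split : Coords.IsEquivariantSplitting F (suc (suc (suc g'))) π) where

  g : ℕ
  g = suc (suc (suc g'))

  private
    module A = CommutativeRing A
    module RA = RingFacts A
    module RF = RingFacts F
    module CA = Coords A g
    module CF = Coords F g
    module BA = SymplecticBasis A g
    module BF = SymplecticBasis F g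
  open CommutativeRing F hiding (zero)
  open SetoidReasoning setoid
  open SymplecticIndices g
  open RetractionIdentity F (suc g') π split using (p; retraction-identity)
  open IsFractionField ff using (hom; injective)
  open RingMorphisms.IsRingHomomorphism hom
  open Antisymmetrisation F using (Ant-cong)

  ι-δ : ∀ {n} (x y : Fin n) → ι (RA.δ x y) ≈ RF.δ x y
  ι-δ x y with x ≟ y
  ... | yes _ = 1#-homo
  ... | no _  = 0#-homo

  ι-∧ : ∀ x y z → mapT A F ι g (BA._∧_∧_ x y z) CF.≈T BF._∧_∧_ x y z
  ι-∧ x y z i j k = trans ι-Ant (Ant-cong _ (BF._⊗_⊗_ x y z) ι-⊗ i j k)
    where
    t = BA._⊗_⊗_ x y z
    ι-⊗ : ∀ i j k → ι (t i j k) ≈ BF._⊗_⊗_ x y z i j k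
    ι-⊗ i j k = trans (*-homo _ _) (*-cong (trans (*-homo _ _) (*-cong (ι-δ i x) (ι-δ j y))) (ι-δ k z))
    ι-sub : ∀ v w → ι (v A.- w) ≈ ι v - ι w
    ι-sub v w = trans (+-homo v (A.- w)) (+-congˡ (-‿homo w))
    ι-Ant : ι (BA._∧_∧_ x y z i j k) ≈ Antisymmetrisation.Ant F (λ i j k → ι (t i j k)) i j k
    ι-Ant = trans (+-homo _ _) (+-cong (trans (+-homo _ _) (+-cong (ι-sub _ _) (ι-sub _ _))) (ι-sub _ _))

  a₀ a₂ b₂ : CF.Idx
  a₀ = a zero
  a₂ = a (suc (suc zero))
  b₂ = b (suc (suc zero))

  u : CA.T3
  u = BA._∧_∧_ (a (suc zero)) (b (suc zero)) a₀

  witness : ∀ n → CA.Dom n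
  witness zero    = u
  witness (suc m) = λ _ → u

  witness-in-Λ³ : ∀ n → CA.InΛ3 n (witness n)
  witness-in-Λ³ zero    = lift (BA.Alt-∧ _ _ _)
  witness-in-Λ³ (suc m) = (λ _ → BA.Alt-∧ _ _ _) ,
    (λ _ _ → CA.0H , λ i j k → A.trans (A.-‿inverseʳ (u i j k)) (A.sym (BA.θ∧-zero i j k)))

  first-coordinate : let v = mapT A F ι g u in
                     ((v CF.-T CF.θ∧ (π v)) CF.+T CF.θ∧ CF.0H) a₂ b₂ a₀ ≈ - p
  first-coordinate = begin
    (v a₂ b₂ a₀ - CF.θ∧ (π v) a₂ b₂ a₀) + CF.θ∧ CF.0H a₂ b₂ a₀
      ≈⟨ +-cong (+-cong v-vanishes (-‿cong θ∧-π-v)) (BF.θ∧-zero a₂ b₂ a₀) ⟩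
    (0# - p) + 0#           ≈⟨ trans (+-identityʳ _) (+-identityˡ _) ⟩
    - p                     ∎
    where
    v = mapT A F ι g u
    -- u has no a_2 ∧ b_2 ∧ a_0 coordinate, as a_1 ∉ {a_2, b_2, a_0}
    v-vanishes : v a₂ b₂ a₀ ≈ 0#
    v-vanishes = trans (ι-∧ (a (suc zero)) (b (suc zero)) a₀ a₂ b₂ a₀)
      (BF.∧-coordinate-zero (a (suc zero)) (b (suc zero)) a₀ a₂ b₂ a₀
        (a-distinct (λ ())) (λ b₂≡a₁ → a≢b _ _ (≡.sym b₂≡a₁)) (a-distinct (λ ())))
    alt-v : CF.Alt v
    alt-v = BF.Alt-resp (ι-∧ _ _ _) (BF.Alt-∧ _ _ _)
    -- θ̌ ∧ π(v) contributes the a_0-coordinate of π(v) = π(a_1 ∧ b_1 ∧ a_0)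
    θ∧-π-v : CF.θ∧ (π v) a₂ b₂ a₀ ≈ p
    θ∧-π-v = trans (BF.θ∧-coordinate (π v) (suc (suc zero)) zero (λ ()))
                   (CF.IsEquivariantSplitting.cong split _ _ alt-v (BF.Alt-∧ _ _ _) (ι-∧ _ _ _) a₀)

  ζ-coordinate : ∀ n → CF.Split.ζ π n (mapDom A F ι g n (witness n)) zero a₂ b₂ a₀ ≈ - p
  ζ-coordinate zero    = first-coordinate
  ζ-coordinate (suc m) = first-coordinate

  ι-natR : ∀ k → ι (natR A k) ≈ natR F k
  ι-natR zero    = 0#-homo
  ι-natR (suc k) = trans (+-homo A.1# (natR A k)) (+-cong 1#-homo (ι-natR k))

  integral⇒unit : ∀ w → ι w ≈ - p → IsUnit A (natR A (suc (suc g')))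
  integral⇒unit w ιw≈-p = A.- w , injective (begin
    ι (natR A (suc (suc g')) A.* A.- w)    ≈⟨ *-homo _ _ ⟩
    ι (natR A (suc (suc g'))) * ι (A.- w)   ≈⟨ *-cong (ι-natR (suc (suc g'))) (-‿homo w) ⟩
    natR F (suc (suc g')) * - ι w           ≈⟨ *-congˡ (-‿cong ιw≈-p) ⟩
    natR F (suc (suc g')) * - - p           ≈⟨ *-congˡ (⁻¹-involutive p) ⟩
    natR F (suc (suc g')) * p               ≈⟨ retraction-identity ⟩
    1#                                      ≈⟨ sym 1#-homo ⟩
    ι A.1#                                  ∎)
    where open import Algebra.Properties.Group +-group using (⁻¹-involutive)

lemma10p7 : ∀ {c ℓ c' ℓ'} (A : CommutativeRing c ℓ) (F : CommutativeRing c' ℓ')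
    (ι : CommutativeRing.Carrier A → CommutativeRing.Carrier F) →
    IsFractionField A F ι → CharZero F →
    (g n : ℕ) → 3 ≤ g → ¬ IsUnit A (natR A (g ∸ 1)) →
    (π : Coords.T3 F g → Coords.H F g) → Coords.IsEquivariantSplitting F g π →
    ∃ λ (u : Coords.Dom A g n) → Coords.InΛ3 A g n u ×
      ¬ InLattice A F ι g n (Coords.Split.ζ F g π n (mapDom A F ι g n u))
lemma10p7 A F ι ff _ (suc (suc (suc g'))) n (s≤s (s≤s (s≤s _))) g-1-not-unit π split =
  witness n , witness-in-Λ³ n , λ { (w , _ , ι-w≈ζ) →
    g-1-not-unit (integral⇒unit (w zero a₂ b₂ a₀)
                                (CommutativeRing.trans F (ι-w≈ζ zero a₂ b₂ a₀) (ζ-coordinate n))) }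
  where open Obstruction A F ι ff g' π split
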